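{- Let $R$ be a finite commutative ring with identity, written as a direct sum of local rings $R = R_1\oplus\cdots\oplus R_n$, where $R_i$ has unique maximal ideal $M_i$, unit group $R_i^*$, and $q_i=|R_i/M_i|$. For $k\ge1$ let $\prod_{i=1}^k R^{**}=\{x_1\cdots x_k : x_1,\ldots,x_k\in R^{**}\}$. (i) If $q_i>3$ for each $i$, then $R^{**}\cdot R^{**}=R^*$. (ii) If $q_1=\cdots=q_s=3$ for some $s\ge1$ and $q_j>3$ for each $j>s$, then for any integer $k\ge2$, $\prod_{i=1}^k R^{**}$ is the set of $(u_1,\ldots,u_n)$ with $u_j\in R_j^*$ arbitrary for $j>s$ and, for all $i\le s$: $u_i\in 1+M_i$ if $k$ is even; $u_i\in R_i^*\setminus(1+M_i)$ if $k$ is odd. In particular, every unit of $R$ is a product of exceptional units of $R$ if and only if $s=1$.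
   Context: A unit $u$ of a commutative ring $R$ with identity is called exceptional if $1-u$ is also a unit; $R^{**}$ denotes the set of exceptional units and $R^*$ the unit group. Every finite commutative ring with identity is uniquely a direct sum of finite local rings; elements are written as tuples. -}

module Defs where

open import Level using (Level; _⊔_) renaming (suc to lsuc)
open import Algebra.Bundles using (CommutativeRing)
open import Algebra.Bundles.Raw using (RawRing)
open import Data.Nat using (ℕ; zero; suc)
open import Data.Fin using (Fin; zero; suc)
open import Data.Product using (Σ; ∃; _×_; _,_)
open import Relation.Nullary using (¬_)
open import Relation.Binary.Bundles using (Setoid)
open import Relation.Binary.PropositionalEquality as ≡ using (_≡_)
open import Function.Bundles using (Bijection)

module _ {c ℓ : Level} (R : RawRing c ℓ) where
  open RawRing R

  IsUnit : Carrier → Set (c ⊔ ℓ)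
  IsUnit x = Σ Carrier λ y → (x * y) ≈ 1#

  IsExceptional : Carrier → Set (c ⊔ ℓ)
  IsExceptional x = IsUnit x × IsUnit (1# + (- x))

  prod : (k : ℕ) → (Fin k → Carrier) → Carrier
  prod zero    xs = 1#
  prod (suc k) xs = xs zero * prod k (λ i → xs (suc i))

  InProdExc : ℕ → Carrier → Set (c ⊔ ℓ)
  InProdExc k x = Σ (Fin k → Carrier) λ xs →
    ((i : Fin k) → IsExceptional (xs i)) × (x ≈ prod k xs)

module _ {c ℓ : Level} (R : CommutativeRing c ℓ) where
  open CommutativeRing R

  record IsIdeal (I : Carrier → Set (c ⊔ ℓ)) : Set (c ⊔ ℓ) where
    field
      resp  : ∀ {x y} → x ≈ y → I x → I y
      zero∈ : I 0#
      +-closed : ∀ {x y} → I x → I y → I (x + y)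
      *-closed : ∀ r {x} → I x → I (r * x)

  IsProperIdeal : (Carrier → Set (c ⊔ ℓ)) → Set (c ⊔ ℓ)
  IsProperIdeal I = IsIdeal I × ¬ I 1#

  IsUniqueMaximalIdeal : (Carrier → Set (c ⊔ ℓ)) → Set (lsuc (c ⊔ ℓ))
  IsUniqueMaximalIdeal M =
    IsProperIdeal M ×
    ((I : Carrier → Set (c ⊔ ℓ)) → IsProperIdeal I → ∀ x → I x → M x)

  IsFinite : Set (c ⊔ ℓ)
  IsFinite = Σ ℕ λ N → Bijection (≡.setoid (Fin N)) setoid

  quotientSetoid : (M : Carrier → Set (c ⊔ ℓ)) → IsIdeal M → Setoid c (c ⊔ ℓ)
  quotientSetoid M isI = record
    { Carrier = Carrier
    ; _≈_ = λ x y → M (x - y)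
    ; isEquivalence = record
      { refl = λ {x} → IsIdeal.resp isI (sym (-‿inverseʳ x)) (IsIdeal.zero∈ isI)
      ; sym = λ {x} {y} p → IsIdeal.resp isI (lemSym x y) (IsIdeal.*-closed isI (- 1#) p)
      ; trans = λ {x} {y} {z} p q → IsIdeal.resp isI (lemTrans x y z) (IsIdeal.+-closed isI p q)
      }
    }
    where
      open import Algebra.Properties.Ring ring using (-‿distribʳ-*; -1*x≈-x; -‿+-comm; -‿involutive)
      open import Relation.Binary.Reasoning.Setoid setoid
      lemSym : ∀ x y → (- 1#) * (x - y) ≈ y - x
      lemSym x y = begin
        (- 1#) * (x - y)  ≈⟨ -1*x≈-x (x - y) ⟩
        - (x + - y)       ≈⟨ sym (-‿+-comm x (- y)) ⟩
        (- x) + (- (- y)) ≈⟨ +-congˡ (-‿involutive y) ⟩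
        (- x) + y         ≈⟨ +-comm (- x) y ⟩
        y - x ∎
      lemTrans : ∀ x y z → (x - y) + (y - z) ≈ x - z
      lemTrans x y z = begin
        (x - y) + (y - z)   ≈⟨ +-assoc x (- y) (y - z) ⟩
        x + (- y + (y - z)) ≈⟨ +-congˡ (sym (+-assoc (- y) y (- z))) ⟩
        x + ((- y + y) - z) ≈⟨ +-congˡ (+-congʳ (-‿inverseˡ y)) ⟩
        x + (0# - z)        ≈⟨ +-congˡ (+-identityˡ (- z)) ⟩
        x - z ∎

record FiniteLocalRing (c ℓ : Level) : Set (lsuc (c ⊔ ℓ)) where
  field
    ring     : CommutativeRing c ℓ
  open CommutativeRing ring using (Carrier)
  field
    finite   : IsFinite ring
    maxIdeal : Carrier → Set (c ⊔ ℓ)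
    isUniqueMaximal : IsUniqueMaximalIdeal ring maxIdeal

  maxIdeal-isIdeal : IsIdeal ring maxIdeal
  maxIdeal-isIdeal = Data.Product.proj₁ (Data.Product.proj₁ isUniqueMaximal)
    where import Data.Product

  residueField : Setoid c (c ⊔ ℓ)
  residueField = quotientSetoid ring maxIdeal maxIdeal-isIdeal

  ResidueCard : ℕ → Set (c ⊔ ℓ)
  ResidueCard q = Bijection (≡.setoid (Fin q)) residueField

  In1+M : Carrier → Set (c ⊔ ℓ)
  In1+M x = maxIdeal (x - 1#)
    where open CommutativeRing ring using (_-_; 1#)

module _ {c ℓ : Level} {n : ℕ} (R : Fin n → FiniteLocalRing c ℓ) where
  private
    C : Fin n → Set c
    C i = CommutativeRing.Carrier (FiniteLocalRing.ring (R i))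
    module Rᵢ (i : Fin n) = CommutativeRing (FiniteLocalRing.ring (R i))

  directSum : RawRing c ℓ
  directSum = record
    { Carrier = (i : Fin n) → C i
    ; _≈_ = λ x y → (i : Fin n) → Rᵢ._≈_ i (x i) (y i)
    ; _+_ = λ x y i → Rᵢ._+_ i (x i) (y i)
    ; _*_ = λ x y i → Rᵢ._*_ i (x i) (y i)
    ; -_  = λ x i → Rᵢ.-_ i (x i)
    ; 0#  = λ i → Rᵢ.0# i
    ; 1#  = λ i → Rᵢ.1# i
    }

module Submission where

-- Everything is decided componentwise: R = R₁ ⊕ ⋯ ⊕ Rₙ, so u is a unit,
-- resp. a product of k exceptional units, iff every component is one
-- (module DirectSum).  Inside a finite local ring L with maximal ideal M
-- the units are exactly the elements outside M, and x is exceptional iff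
-- x ∉ M and x ≢ 1 (mod M) (module FiniteLocal).  Counting residues then
-- settles the two kinds of components.
--   * |L/M| = 3: the residues are 0, 1, -1, pairwise distinct, so the
--     exceptional units are exactly the x ≡ -1; a product of k of them is
--     ≡ (-1)ᵏ, and conversely every unit with that residue is such a
--     product once k ≥ 2 (module ResidueFieldOfSize3).
--   * |L/M| > 3: for a unit u pick t ≢ 0, 1, u; then t and u t⁻¹ are
--     exceptional, so u is a product of two, hence of any k ≥ 2, of them
--     (module LargeResidueField).

open import Defs
open import Level using (Level; _⊔_)
open import Algebra.Bundles using (CommutativeRing)
open import Data.Nat using (ℕ; zero; suc; _<_; _≤_; _%_; z≤n; s≤s)
import Data.Nat.Properties as ℕ
open import Data.Fin using (Fin; zero; suc; toℕ)
import Data.Fin as Fin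
import Data.Fin.Properties as Fin
open import Data.Vec.Functional using (_∷_; [])
open import Data.Product using (Σ; ∃; ∃₂; _×_; _,_; proj₁; proj₂)
open import Data.Sum using (_⊎_; inj₁; inj₂)
open import Data.Empty using (⊥; ⊥-elim)
open import Function using (_∘_)
open import Function.Bundles using (_⇔_; mk⇔; Bijection; module Equivalence)
open import Relation.Nullary using (¬_; Dec; yes; no)
import Relation.Nullary.Decidable as Dec
open import Relation.Binary.Bundles using (Setoid)
open import Relation.Binary.Definitions using (Decidable)
open import Relation.Binary.PropositionalEquality as ≡ using (_≡_)

parity-cases : ∀ k → k % 2 ≡ 0 ⊎ k % 2 ≡ 1
parity-cases zero          = inj₁ ≡.refl
parity-cases (suc zero)    = inj₂ ≡.refl
parity-cases (suc (suc k)) = parity-cases k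

module UnitFacts {c ℓ : Level} (R : CommutativeRing c ℓ) where
  open CommutativeRing R hiding (zero)
  open import Algebra.Properties.Ring ring using (-1*x≈-x; -‿involutive)
  open import Algebra.Properties.CommutativeSemigroup *-commutativeSemigroup
    using (interchange)
  open import Relation.Binary.Reasoning.Setoid setoid

  Unit : Carrier → Set (c ⊔ ℓ)
  Unit = IsUnit rawRing

  Exceptional : Carrier → Set (c ⊔ ℓ)
  Exceptional = IsExceptional rawRing

  ProductOf : ℕ → Carrier → Set (c ⊔ ℓ)
  ProductOf = InProdExc rawRing

  one-unit : Unit 1#
  one-unit = 1# , *-identityˡ 1#

  Multiples : Carrier → Carrier → Set (c ⊔ ℓ)
  Multiples x y = Σ Carrier λ r → y ≈ r * x

  multiples-ideal : ∀ x → IsIdeal R (Multiples x)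
  multiples-ideal x = record
    { resp     = λ { y≈z (r , y≈rx) → r , trans (sym y≈z) y≈rx }
    ; zero∈    = 0# , sym (zeroˡ x)
    ; +-closed = λ { (r , y≈rx) (s , z≈sx) →
                       r + s , trans (+-cong y≈rx z≈sx) (sym (distribʳ x r s)) }
    ; *-closed = λ { t (r , y≈rx) → t * r , trans (*-congˡ y≈rx) (sym (*-assoc t r x)) }
    }

  1∈multiples⇒unit : ∀ {x} → Multiples x 1# → Unit x
  1∈multiples⇒unit {x} (r , 1≈rx) = r , trans (*-comm x r) (sym 1≈rx)

  minusOne-twice : ∀ x → (- 1#) * ((- 1#) * x) ≈ x
  minusOne-twice x = begin
    (- 1#) * ((- 1#) * x) ≈⟨ *-congˡ (-1*x≈-x x) ⟩
    (- 1#) * (- x)        ≈⟨ -1*x≈-x (- x) ⟩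
    - (- x)               ≈⟨ -‿involutive x ⟩
    x                     ∎

  unit-resp : ∀ {x y} → x ≈ y → Unit x → Unit y
  unit-resp x≈y (v , xv≈1) = v , trans (*-congʳ (sym x≈y)) xv≈1

  inverse-unit : ∀ {x} (unit : Unit x) → Unit (proj₁ unit)
  inverse-unit {x} (v , xv≈1) = x , trans (*-comm v x) xv≈1

  unit-* : ∀ {a b} → Unit a → Unit b → Unit (a * b)
  unit-* {a} {b} (v , av≈1) (w , bw≈1) = v * w , (begin
    (a * b) * (v * w) ≈⟨ interchange a b v w ⟩
    (a * v) * (b * w) ≈⟨ *-cong av≈1 bw≈1 ⟩
    1# * 1#           ≈⟨ *-identityˡ 1# ⟩
    1#                ∎)

  product-unit : ∀ k {x} → ProductOf k x → Unit x
  product-unit zero    (xs , exc , x≈1) = unit-resp (sym x≈1) one-unit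
  product-unit (suc k) (xs , exc , x≈p) = unit-resp (sym x≈p)
    (unit-* (proj₁ (exc zero)) (product-unit k (xs ∘ suc , exc ∘ suc , refl)))

  empty-product : ProductOf 0 1#
  empty-product = [] , (λ ()) , refl

  prepend : ∀ {k a x y} → Exceptional a → ProductOf k y → x ≈ a * y →
            ProductOf (suc k) x
  prepend {a = a} excA (ys , excYs , y≈p) x≈ay =
    a ∷ ys , excAll , trans x≈ay (*-congˡ y≈p)
    where
    excAll : ∀ i → Exceptional ((a ∷ ys) i)
    excAll zero    = excA
    excAll (suc i) = excYs i

  single : ∀ {x} → Exceptional x → ProductOf 1 x
  single {x} excX = prepend excX empty-product (sym (*-identityʳ x))

  prepend-minusOnes : Exceptional (- 1#) → ∀ {k x} → ProductOf k x →
                      ProductOf (suc (suc k)) x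
  prepend-minusOnes exc {x = x} p =
    prepend exc (prepend exc p refl) (sym (minusOne-twice x))

module Congruence {c ℓ : Level} (R : CommutativeRing c ℓ)
                  (I : CommutativeRing.Carrier R → Set (c ⊔ ℓ))
                  (I-ideal : IsIdeal R I) where
  open CommutativeRing R hiding (zero)
  open IsIdeal I-ideal
  open import Algebra.Properties.Ring ring
    using (-1*x≈-x; -0#≈0#; -‿+-comm; [y-z]x≈yx-zx; //-rightDividesʳ)
  open import Algebra.Properties.CommutativeSemigroup +-commutativeSemigroup
    using (interchange)
  open import Relation.Binary.Reasoning.Setoid setoid
  open UnitFacts R using (Unit)

  open Setoid (quotientSetoid R I I-ideal) public
    using () renaming (_≈_ to _~_; refl to ~-refl; sym to ~-sym; trans to ~-trans)

  ≈⇒~ : ∀ {x y} → x ≈ y → x ~ y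
  ≈⇒~ {x} x≈y = resp (+-congˡ (-‿cong x≈y)) (~-refl {x})

  ~-resp : ∀ {x x′ y y′} → x ≈ x′ → y ≈ y′ → x ~ y → x′ ~ y′
  ~-resp x≈x′ y≈y′ x~y = ~-trans (≈⇒~ (sym x≈x′)) (~-trans x~y (≈⇒~ y≈y′))

  ∈⇒~0 : ∀ {x} → I x → x ~ 0#
  ∈⇒~0 {x} = resp (sym (trans (+-congˡ -0#≈0#) (+-identityʳ x)))

  ~0⇒∈ : ∀ {x} → x ~ 0# → I x
  ~0⇒∈ {x} = resp (trans (+-congˡ -0#≈0#) (+-identityʳ x))

  ~-+ : ∀ {a a′ b b′} → a ~ a′ → b ~ b′ → (a + b) ~ (a′ + b′)
  ~-+ {a} {a′} {b} {b′} a~a′ b~b′ = resp difference (+-closed a~a′ b~b′)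
    where
    difference : (a - a′) + (b - b′) ≈ (a + b) - (a′ + b′)
    difference = begin
      (a + - a′) + (b + - b′) ≈⟨ interchange a (- a′) b (- b′) ⟩
      (a + b) + (- a′ + - b′) ≈⟨ +-congˡ (-‿+-comm a′ b′) ⟩
      (a + b) - (a′ + b′)     ∎

  ~-*ʳ : ∀ b {a a′} → a ~ a′ → (a * b) ~ (a′ * b)
  ~-*ʳ b {a} {a′} a~a′ =
    resp (trans (*-comm b (a - a′)) ([y-z]x≈yx-zx b a a′)) (*-closed b a~a′)

  ~-* : ∀ {a a′ b b′} → a ~ a′ → b ~ b′ → (a * b) ~ (a′ * b′)
  ~-* {a} {a′} {b} {b′} a~a′ b~b′ =
    ~-trans (~-*ʳ b a~a′) (~-resp (*-comm b a′) (*-comm b′ a′) (~-*ʳ a′ b~b′))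

  ~-neg : ∀ {a a′} → a ~ a′ → (- a) ~ (- a′)
  ~-neg {a} {a′} a~a′ = ~-resp (-1*x≈-x a) (-1*x≈-x a′) (~-* (~-refl { - 1#}) a~a′)

  ~-cancel+ʳ : ∀ {a b} d → (a + d) ~ (b + d) → a ~ b
  ~-cancel+ʳ {a} {b} d ad~bd =
    ~-resp (//-rightDividesʳ d a) (//-rightDividesʳ d b) (~-+ ad~bd (~-refl { - d}))

  unit∉ : ¬ I 1# → ∀ {x} → Unit x → ¬ I x
  unit∉ 1∉I {x} (v , xv≈1) x∈I = 1∉I (resp (trans (*-comm v x) xv≈1) (*-closed v x∈I))

module FiniteLocal {c ℓ : Level} (L : FiniteLocalRing c ℓ) where
  open FiniteLocalRing L
    using (finite; isUniqueMaximal; maxIdeal-isIdeal; ResidueCard)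
    renaming (ring to R; maxIdeal to M)
  open CommutativeRing R hiding (zero)
  open import Algebra.Properties.Ring ring using (-0#≈0#; -‿involutive)
  open UnitFacts R public
  open Congruence R M maxIdeal-isIdeal public

  1∉M : ¬ M 1#
  1∉M = proj₂ (proj₁ isUniqueMaximal)

  1≁0 : ¬ (1# ~ 0#)
  1≁0 = 1∉M ∘ ~0⇒∈

  -1≁0 : ¬ (- 1# ~ 0#)
  -1≁0 -1~0 = 1≁0 (~-resp (-‿involutive 1#) -0#≈0# (~-neg -1~0))

  private
    module Enumeration = Bijection (proj₂ finite)

  index : Carrier → Fin (proj₁ finite)
  index x = proj₁ (Enumeration.surjective x)

  index-spec : ∀ x → Enumeration.to (index x) ≈ x
  index-spec x = proj₂ (Enumeration.surjective x) ≡.refl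

  _≈?_ : Decidable _≈_
  x ≈? y = Dec.map′
    (λ same → trans (sym (index-spec x)) (trans (Enumeration.cong same) (index-spec y)))
    (λ x≈y → Enumeration.injective (trans (index-spec x) (trans x≈y (sym (index-spec y)))))
    (index x Fin.≟ index y)

  unit? : ∀ x → Dec (Unit x)
  unit? x = Dec.map′
    (λ { (j , x·j≈1) → Enumeration.to j , x·j≈1 })
    (λ { (y , xy≈1) → index y , trans (*-congˡ (index-spec y)) xy≈1 })
    (Fin.any? λ j → (x * Enumeration.to j) ≈? 1#)

  -- a non-unit x generates a proper ideal, which lies in M
  ∉M⇒unit : ∀ {x} → ¬ M x → Unit x
  ∉M⇒unit {x} x∉M with unit? x
  ... | yes unit = unit
  ... | no ¬unit = ⊥-elim (x∉M (proj₂ isUniqueMaximal (Multiples x)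
                                  (multiples-ideal x , ¬unit ∘ 1∈multiples⇒unit) x x∈multiples))
    where
    x∈multiples : Multiples x x
    x∈multiples = 1# , sym (*-identityˡ x)

  unit⇒∉M : ∀ {x} → Unit x → ¬ M x
  unit⇒∉M = unit∉ 1∉M

  -- x is exceptional iff x ∉ M and x ≢ 1 (note 1 ~ x means 1 - x ∈ M)
  exceptional⇒≁1 : ∀ {x} → Exceptional x → ¬ (1# ~ x)
  exceptional⇒≁1 = unit⇒∉M ∘ proj₂

  exceptional-intro : ∀ {x} → ¬ M x → ¬ (1# ~ x) → Exceptional x
  exceptional-intro x∉M 1≁x = ∉M⇒unit x∉M , ∉M⇒unit 1≁x

  module Residues {q : ℕ} (B : ResidueCard q) where
    open Bijection B using (to; injective; surjective)

    residue : Carrier → Fin q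
    residue y = proj₁ (surjective y)

    residue-spec : ∀ y → to (residue y) ~ y
    residue-spec y = proj₂ (surjective y) ≡.refl

    pigeonhole : ∀ {m} → q < m → (a : Fin m → Carrier) →
                 ∃₂ λ i j → i Fin.< j × a i ~ a j
    pigeonhole q<m a with Fin.pigeonhole q<m (residue ∘ a)
    ... | i , j , i<j , same = i , j , i<j ,
      ~-trans (~-sym (residue-spec (a i)))
              (~-trans (≡.subst (λ r → to (residue (a i)) ~ to r) same ~-refl)
                       (residue-spec (a j)))

    avoid : ∀ {m} → m < q → (a : Fin m → Carrier) → ∃ λ t → ∀ i → ¬ t ~ a i
    avoid {m} m<q a
      with Fin.¬∀⟶∃¬ q (λ r → ∃ λ i → r ≡ residue (a i))
             (λ r → Fin.any? (λ i → r Fin.≟ residue (a i))) notAllHit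
      where
      notAllHit : ¬ (∀ r → ∃ λ i → r ≡ residue (a i))
      notAllHit hit with Fin.pigeonhole m<q (proj₁ ∘ hit)
      ... | r , r′ , r<r′ , same = Fin.<⇒≢ r<r′
        (≡.trans (proj₂ (hit r)) (≡.trans (≡.cong (residue ∘ a) same) (≡.sym (proj₂ (hit r′)))))
    ... | r , missed = to r , λ i to-r~ai →
      missed (i , injective (~-trans to-r~ai (~-sym (residue-spec (a i)))))

    data SomePairCongruent (w x y z : Carrier) : Set (c ⊔ ℓ) where
      w~x : w ~ x → SomePairCongruent w x y z
      w~y : w ~ y → SomePairCongruent w x y z
      w~z : w ~ z → SomePairCongruent w x y z
      x~y : x ~ y → SomePairCongruent w x y z
      x~z : x ~ z → SomePairCongruent w x y z
      y~z : y ~ z → SomePairCongruent w x y z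

    fourElements : q < 4 → ∀ w x y z → SomePairCongruent w x y z
    fourElements q<4 w x y z with pigeonhole q<4 (w ∷ x ∷ y ∷ z ∷ [])
    ... | i , j , i<j , same = select i j i<j same
      where
      select : ∀ i j → i Fin.< j → (w ∷ x ∷ y ∷ z ∷ []) i ~ (w ∷ x ∷ y ∷ z ∷ []) j →
               SomePairCongruent w x y z
      select zero                (suc zero)                _ = w~x
      select zero                (suc (suc zero))          _ = w~y
      select zero                (suc (suc (suc zero)))    _ = w~z
      select (suc zero)          (suc (suc zero))          _ = x~y
      select (suc zero)          (suc (suc (suc zero)))    _ = x~z
      select (suc (suc zero))    (suc (suc (suc zero)))    _ = y~z
      select _                   zero                      ()
      select (suc zero)          (suc zero)                (s≤s ())
      select (suc (suc _))       (suc zero)                (s≤s ())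
      select (suc (suc zero))    (suc (suc zero))          (s≤s (s≤s ()))
      select (suc (suc (suc _))) (suc (suc zero))          (s≤s (s≤s ()))
      select (suc (suc (suc _))) (suc (suc (suc zero)))    (s≤s (s≤s (s≤s ())))

module ResidueFieldOfSize3 {c ℓ : Level} (L : FiniteLocalRing c ℓ)
                           (B : FiniteLocalRing.ResidueCard L 3) where
  open FiniteLocal L public
  open Residues B
  open CommutativeRing (FiniteLocalRing.ring L) hiding (zero)
  open import Algebra.Properties.Ring ring using (-1*x≈-x; -‿involutive)

  -- 1 ≢ -1: otherwise 0, 1, t, t + 1 (t ≢ 0, 1) would be four residues
  1≁-1 : ¬ (1# ~ - 1#)
  1≁-1 1~-1 with avoid (s≤s (s≤s (s≤s z≤n))) (0# ∷ 1# ∷ [])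
  ... | t , t≁ with fourElements ℕ.≤-refl 0# 1# t (t + 1#)
  ... | w~x 0~1   = 1≁0 (~-sym 0~1)
  ... | w~y 0~t   = t≁ zero (~-sym 0~t)
  ... | w~z 0~t+1 = t≁ (suc zero) (~-trans t~-1 (~-sym 1~-1))
    where
    t~-1 : t ~ - 1#
    t~-1 = ~-cancel+ʳ 1# (~-resp refl (sym (-‿inverseˡ 1#)) (~-sym 0~t+1))
  ... | x~y 1~t   = t≁ (suc zero) (~-sym 1~t)
  ... | x~z 1~t+1 = t≁ zero (~-sym (~-cancel+ʳ 1# (~-resp (sym (+-identityˡ 1#)) refl 1~t+1)))
  ... | y~z t~t+1 = 1≁0 (~-sym (~-cancel+ʳ t
          (~-resp (trans (sym (+-identityˡ t)) refl) (+-comm t 1#) t~t+1)))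

  unit-residue : ∀ {x} → Unit x → x ~ 1# ⊎ x ~ - 1#
  unit-residue {x} unit with fourElements ℕ.≤-refl 0# 1# (- 1#) x
  ... | w~x 0~1  = ⊥-elim (1≁0 (~-sym 0~1))
  ... | w~y 0~-1 = ⊥-elim (-1≁0 (~-sym 0~-1))
  ... | w~z 0~x  = ⊥-elim (unit⇒∉M unit (~0⇒∈ (~-sym 0~x)))
  ... | x~y 1~-1 = ⊥-elim (1≁-1 1~-1)
  ... | x~z 1~x  = inj₁ (~-sym 1~x)
  ... | y~z -1~x = inj₂ (~-sym -1~x)

  exceptional⇒~-1 : ∀ {x} → Exceptional x → x ~ - 1#
  exceptional⇒~-1 exc with unit-residue (proj₁ exc)
  ... | inj₁ x~1  = ⊥-elim (exceptional⇒≁1 exc (~-sym x~1))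
  ... | inj₂ x~-1 = x~-1

  ~-1⇒exceptional : ∀ {x} → x ~ - 1# → Exceptional x
  ~-1⇒exceptional x~-1 = exceptional-intro
    (λ x∈M → -1≁0 (~-trans (~-sym x~-1) (∈⇒~0 x∈M)))
    (λ 1~x → 1≁-1 (~-trans 1~x x~-1))

  minusOne-exceptional : Exceptional (- 1#)
  minusOne-exceptional = ~-1⇒exceptional ~-refl

  parity : ∀ k {x} → ProductOf k x → (k % 2 ≡ 0 → x ~ 1#) × (k % 2 ≡ 1 → x ~ - 1#)
  parity zero          (_ , _ , x≈1)     = (λ _ → ≈⇒~ x≈1) , λ ()
  parity (suc zero)    (xs , exc , x≈p)  =
    (λ ()) , λ _ → ~-trans (≈⇒~ (trans x≈p (*-identityʳ (xs zero)))) (exceptional⇒~-1 (exc zero))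
  parity (suc (suc k)) {x} (xs , exc , x≈p) =
    (λ even → ~-trans x~rest (proj₁ rest-parity even)) ,
    (λ odd → ~-trans x~rest (proj₂ rest-parity odd))
    where
    rest : Carrier
    rest = prod rawRing k (λ i → xs (suc (suc i)))
    rest-parity : (k % 2 ≡ 0 → rest ~ 1#) × (k % 2 ≡ 1 → rest ~ - 1#)
    rest-parity = parity k ((λ i → xs (suc (suc i))) , (λ i → exc (suc (suc i))) , refl)
    -- the first two factors are both ≡ -1 and cancel
    x~rest : x ~ rest
    x~rest = ~-trans (≈⇒~ x≈p) (~-resp refl (minusOne-twice rest)
      (~-* (exceptional⇒~-1 (exc zero)) (~-* (exceptional⇒~-1 (exc (suc zero))) ~-refl)))

  ParityCondition : ℕ → Carrier → Set (c ⊔ ℓ)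
  ParityCondition k x = (k % 2 ≡ 0 → x ~ 1#) × (k % 2 ≡ 1 → ¬ x ~ 1#)

  realisation : ∀ k {x} → 2 ≤ k → Unit x → ParityCondition k x → ProductOf k x
  realisation (suc zero) (s≤s ())
  realisation (suc (suc zero)) {x} _ _ (even , _) =
    prepend minusOne-exceptional (single (~-1⇒exceptional (~-neg (even ≡.refl))))
            (sym (trans (-1*x≈-x (- x)) (-‿involutive x)))
  realisation (suc (suc (suc zero))) _ unit (_ , odd) with unit-residue unit
  ... | inj₁ x~1  = ⊥-elim (odd ≡.refl x~1)
  ... | inj₂ x~-1 = prepend-minusOnes minusOne-exceptional (single (~-1⇒exceptional x~-1))
  realisation (suc (suc (suc (suc k)))) _ unit condition =
    prepend-minusOnes minusOne-exceptional (realisation (suc (suc k)) (s≤s (s≤s z≤n)) unit condition)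

  product⇔ : ∀ k {x} → 2 ≤ k → ProductOf k x ⇔ (Unit x × ParityCondition k x)
  product⇔ k 2≤k = mk⇔
    (λ p → product-unit k p , proj₁ (parity k p) ,
           λ odd x~1 → 1≁-1 (~-trans (~-sym x~1) (proj₂ (parity k p) odd)))
    (λ { (unit , condition) → realisation k 2≤k unit condition })

module LargeResidueField {c ℓ : Level} (L : FiniteLocalRing c ℓ) {q : ℕ}
                         (B : FiniteLocalRing.ResidueCard L q) where
  open FiniteLocal L
  open Residues B
  open CommutativeRing (FiniteLocalRing.ring L) hiding (zero)
  open import Algebra.Properties.Ring ring using (x[y-z]≈xy-xz)
  open import Algebra.Properties.CommutativeSemigroup *-commutativeSemigroup using (x∙yz≈y∙xz)
  open import Relation.Binary.Reasoning.Setoid setoid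

  ≁0,1⇒exceptional : ∀ {t} → ¬ t ~ 0# → ¬ t ~ 1# → Exceptional t
  ≁0,1⇒exceptional t≁0 t≁1 = exceptional-intro (t≁0 ∘ ∈⇒~0) (t≁1 ∘ ~-sym)

  exceptional-exists : 2 < q → Σ Carrier Exceptional
  exceptional-exists 2<q with avoid 2<q (0# ∷ 1# ∷ [])
  ... | t , t≁ = t , ≁0,1⇒exceptional (t≁ zero) (t≁ (suc zero))

  -- u = t · (u t⁻¹) for any t ≢ 0, 1, u; both factors are exceptional
  productOfTwo : 3 < q → ∀ {u} → Unit u → ProductOf 2 u
  productOfTwo 3<q {u} unit-u with avoid 3<q (0# ∷ 1# ∷ u ∷ [])
  ... | t , t≁ = prepend t-exc (single b-exc) (sym t·ut′≈u)
    where
    t-exc : Exceptional t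
    t-exc = ≁0,1⇒exceptional (t≁ zero) (t≁ (suc zero))
    t′ : Carrier
    t′ = proj₁ (proj₁ t-exc)
    tt′≈1 : t * t′ ≈ 1#
    tt′≈1 = proj₂ (proj₁ t-exc)
    b : Carrier
    b = u * t′
    t·ut′≈u : t * (u * t′) ≈ u
    t·ut′≈u = begin
      t * (u * t′) ≈⟨ x∙yz≈y∙xz t u t′ ⟩
      u * (t * t′) ≈⟨ *-congˡ tt′≈1 ⟩
      u * 1#       ≈⟨ *-identityʳ u ⟩
      u            ∎
    -- t (1 - b) = t - u ∉ M since t ≢ u
    t[1-b]≈t-u : t * (1# - b) ≈ t - u
    t[1-b]≈t-u = begin
      t * (1# - b)       ≈⟨ x[y-z]≈xy-xz t 1# b ⟩
      t * 1# - t * b     ≈⟨ +-cong (*-identityʳ t) (-‿cong t·ut′≈u) ⟩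
      t - u              ∎
    b-exc : Exceptional b
    b-exc = exceptional-intro
      (unit⇒∉M (unit-* unit-u (inverse-unit (proj₁ t-exc))))
      (λ 1~b → t≁ (suc (suc zero)) (resp t[1-b]≈t-u (*-closed t 1~b)))
      where open IsIdeal (FiniteLocalRing.maxIdeal-isIdeal L)

  -- u = t · (t⁻¹ u) with t exceptional adds one factor
  productOfAny : 3 < q → ∀ k {u} → 2 ≤ k → Unit u → ProductOf k u
  productOfAny 3<q (suc zero)          (s≤s ())
  productOfAny 3<q (suc (suc zero))    _ unit-u = productOfTwo 3<q unit-u
  productOfAny 3<q (suc (suc (suc k))) {u} _ unit-u =
    prepend t-exc (productOfAny 3<q (suc (suc k)) (s≤s (s≤s z≤n)) (unit-* t′-unit unit-u))
            (sym t·t′u≈u)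
    where
    t : Carrier
    t = proj₁ (exceptional-exists (ℕ.<-trans (ℕ.n<1+n 2) 3<q))
    t-exc : Exceptional t
    t-exc = proj₂ (exceptional-exists (ℕ.<-trans (ℕ.n<1+n 2) 3<q))
    t′ : Carrier
    t′ = proj₁ (proj₁ t-exc)
    t′-unit : Unit t′
    t′-unit = inverse-unit (proj₁ t-exc)
    t·t′u≈u : t * (t′ * u) ≈ u
    t·t′u≈u = begin
      t * (t′ * u) ≈⟨ sym (*-assoc t t′ u) ⟩
      (t * t′) * u ≈⟨ *-congʳ (proj₂ (proj₁ t-exc)) ⟩
      1# * u       ≈⟨ *-identityˡ u ⟩
      u            ∎

module DirectSum {c ℓ : Level} {n : ℕ} (R : Fin n → FiniteLocalRing c ℓ) where
  private
    module Rᵢ (i : Fin n) = CommutativeRing (FiniteLocalRing.ring (R i))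

  unit⇔ : ∀ u → IsUnit (directSum R) u ⇔ (∀ i → IsUnit (Rᵢ.rawRing i) (u i))
  unit⇔ u = mk⇔ (λ { (v , uv≈1) i → v i , uv≈1 i })
                (λ units → (λ i → proj₁ (units i)) , (λ i → proj₂ (units i)))

  exceptional⇔ : ∀ x → IsExceptional (directSum R) x ⇔ (∀ i → IsExceptional (Rᵢ.rawRing i) (x i))
  exceptional⇔ x = mk⇔
    (λ { (unit , unit′) i → Equivalence.to (unit⇔ _) unit i , Equivalence.to (unit⇔ _) unit′ i })
    (λ exc → Equivalence.from (unit⇔ _) (proj₁ ∘ exc) , Equivalence.from (unit⇔ _) (proj₂ ∘ exc))

  prod-component : ∀ k xs i → Rᵢ._≈_ i (prod (directSum R) k xs i) (prod (Rᵢ.rawRing i) k (λ m → xs m i))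
  prod-component zero    xs i = Rᵢ.refl i
  prod-component (suc k) xs i = Rᵢ.*-congˡ i (prod-component k (xs ∘ suc) i)

  product⇔ : ∀ k u → InProdExc (directSum R) k u ⇔ (∀ i → InProdExc (Rᵢ.rawRing i) k (u i))
  product⇔ k u = mk⇔
    (λ { (xs , exc , u≈p) i →
           (λ m → xs m i) , (λ m → Equivalence.to (exceptional⇔ (xs m)) (exc m) i) ,
           Rᵢ.trans i (u≈p i) (prod-component k xs i) })
    (λ products →
      let xs = λ m i → proj₁ (products i) m in
      xs , (λ m → Equivalence.from (exceptional⇔ (xs m)) (λ i → proj₁ (proj₂ (products i)) m)) ,
      (λ i → Rᵢ.trans i (proj₂ (proj₂ (products i))) (Rᵢ.sym i (prod-component k xs i))))

LargeResidue : ∀ {c ℓ} → FiniteLocalRing c ℓ → Set (c ⊔ ℓ)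
LargeResidue L = Σ ℕ λ q → FiniteLocalRing.ResidueCard L q × 3 < q

large-product⇔ : ∀ {c ℓ} (L : FiniteLocalRing c ℓ) → LargeResidue L → ∀ k {u} → 2 ≤ k →
                 FiniteLocal.ProductOf L k u ⇔ FiniteLocal.Unit L u
large-product⇔ L (q , B , 3<q) k 2≤k =
  mk⇔ (FiniteLocal.product-unit L k) (LargeResidueField.productOfAny L B 3<q k 2≤k)

unitsAreProductsOfTwo : ∀ {c ℓ} (n : ℕ) (R : Fin n → FiniteLocalRing c ℓ) →
  (∀ i → LargeResidue (R i)) →
  ∀ u → IsUnit (directSum R) u ⇔ InProdExc (directSum R) 2 u
unitsAreProductsOfTwo n R large u = mk⇔
  (λ unit → from (product⇔ 2 u) λ i →
     from (large-product⇔ (R i) (large i) 2 (s≤s (s≤s z≤n))) (to (unit⇔ u) unit i))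
  (λ p → from (unit⇔ u) λ i →
     to (large-product⇔ (R i) (large i) 2 (s≤s (s≤s z≤n))) (to (product⇔ 2 u) p i))
  where
  open DirectSum R
  open Equivalence

productsOfK : ∀ {c ℓ} (n : ℕ) (R : Fin n → FiniteLocalRing c ℓ) (s : ℕ) →
  (∀ i → toℕ i < s → FiniteLocalRing.ResidueCard (R i) 3) →
  (∀ i → s ≤ toℕ i → LargeResidue (R i)) →
  (k : ℕ) → 2 ≤ k → ∀ u →
  InProdExc (directSum R) k u ⇔
    (((j : Fin n) →
        IsUnit (CommutativeRing.rawRing (FiniteLocalRing.ring (R j))) (u j))
     × ((i : Fin n) → toℕ i < s →
        (k % 2 ≡ 0 → FiniteLocalRing.In1+M (R i) (u i))
        × (k % 2 ≡ 1 → ¬ FiniteLocalRing.In1+M (R i) (u i))))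
productsOfK {c} {ℓ} n R s size3 large k 2≤k u = mk⇔ necessary sufficient
  where
  open DirectSum R
  open Equivalence
  module Size3 (i : Fin n) (i<s : toℕ i < s) = ResidueFieldOfSize3 (R i) (size3 i i<s)

  Conditions : Set (c ⊔ ℓ)
  Conditions = (∀ j → FiniteLocal.Unit (R j) (u j)) ×
               (∀ i (i<s : toℕ i < s) → Size3.ParityCondition i i<s k (u i))

  necessary : InProdExc (directSum R) k u → Conditions
  necessary p =
    (λ j → FiniteLocal.product-unit (R j) k (to (product⇔ k u) p j)) ,
    (λ i i<s → proj₂ (to (Size3.product⇔ i i<s k 2≤k) (to (product⇔ k u) p i)))

  sufficient : Conditions → InProdExc (directSum R) k u
  sufficient (units , conditions) = from (product⇔ k u) component
    where
    component : ∀ j → FiniteLocal.ProductOf (R j) k (u j)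
    component j with toℕ j ℕ.<? s
    ... | yes j<s = from (Size3.product⇔ j j<s k 2≤k) (units j , conditions j j<s)
    ... | no  j≮s = from (large-product⇔ (R j) (large j (ℕ.≮⇒≥ j≮s)) k 2≤k) (units j)

-- If s = 1, every unit u is ≡ ±1 in R₁, hence a product of 2 or of 3
-- exceptional units.
unitsAreProducts-s≡1 : ∀ {c ℓ} (n : ℕ) (R : Fin n → FiniteLocalRing c ℓ) → 1 ≤ n →
  (∀ i → toℕ i < 1 → FiniteLocalRing.ResidueCard (R i) 3) →
  (∀ i → 1 ≤ toℕ i → LargeResidue (R i)) →
  ∀ u → IsUnit (directSum R) u → Σ ℕ λ k → 1 ≤ k × InProdExc (directSum R) k u
unitsAreProducts-s≡1 (suc n) R _ size3 large u unit =
  byResidue (R₀.unit-residue (to (unit⇔ u) unit zero))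
  where
  open DirectSum R
  open Equivalence
  module R₀ = ResidueFieldOfSize3 (R zero) (size3 zero (s≤s z≤n))

  realise : ∀ k → 2 ≤ k → R₀.ParityCondition k (u zero) → InProdExc (directSum R) k u
  realise k 2≤k condition = from (productsOfK (suc n) R 1 size3 large k 2≤k u)
    (to (unit⇔ u) unit , λ { zero _ → condition ; (suc i) (s≤s ()) })

  module L₀ = CommutativeRing (FiniteLocalRing.ring (R zero))

  byResidue : R₀._~_ (u zero) L₀.1# ⊎ R₀._~_ (u zero) (L₀.- L₀.1#) →
              Σ ℕ λ k → 1 ≤ k × InProdExc (directSum R) k u
  byResidue (inj₁ u₀~1)  = 2 , s≤s z≤n , realise 2 (s≤s (s≤s z≤n)) ((λ _ → u₀~1) , λ ())
  byResidue (inj₂ u₀~-1) = 3 , s≤s z≤n , realise 3 (s≤s (s≤s z≤n))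
    ((λ ()) , λ _ u₀~1 → R₀.1≁-1 (R₀.~-trans (R₀.~-sym u₀~1) u₀~-1))

-- If s ≥ 2, the unit u = (1, -1, 1, …, 1) is no product of exceptional
-- units: an even number of factors forces u₂ ≡ 1, an odd one u₁ ≡ -1.
productsExist⇒s≡1 : ∀ {c ℓ} (n : ℕ) (R : Fin n → FiniteLocalRing c ℓ) (s : ℕ) →
  1 ≤ s → s ≤ n →
  (∀ i → toℕ i < s → FiniteLocalRing.ResidueCard (R i) 3) →
  (∀ u → IsUnit (directSum R) u → Σ ℕ λ k → 1 ≤ k × InProdExc (directSum R) k u) →
  s ≡ 1
productsExist⇒s≡1 n R (suc zero) _ _ _ _ = ≡.refl
productsExist⇒s≡1 (suc zero) R (suc (suc s)) _ (s≤s ()) _ _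
productsExist⇒s≡1 (suc (suc n)) R (suc (suc s)) _ _ size3 allProducts =
  ⊥-elim (byParity (parity-cases k))
  where
  open DirectSum R
  open Equivalence
  module R₀ = ResidueFieldOfSize3 (R zero) (size3 zero (s≤s z≤n))
  module R₁ = ResidueFieldOfSize3 (R (suc zero)) (size3 (suc zero) (s≤s (s≤s z≤n)))
  module Rᵢ (i : Fin (suc (suc n))) = CommutativeRing (FiniteLocalRing.ring (R i))

  u : ∀ i → Rᵢ.Carrier i
  u (suc zero) = Rᵢ.-_ (suc zero) (Rᵢ.1# (suc zero))
  u i          = Rᵢ.1# i

  u-unit : IsUnit (directSum R) u
  u-unit = from (unit⇔ u) λ
    { zero          → FiniteLocal.one-unit (R zero)
    ; (suc zero)    → proj₁ R₁.minusOne-exceptional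
    ; (suc (suc i)) → FiniteLocal.one-unit (R (suc (suc i)))
    }

  k : ℕ
  k = proj₁ (allProducts u u-unit)

  u-product : ∀ i → FiniteLocal.ProductOf (R i) k (u i)
  u-product = to (product⇔ k u) (proj₂ (proj₂ (allProducts u u-unit)))

  byParity : k % 2 ≡ 0 ⊎ k % 2 ≡ 1 → ⊥
  byParity (inj₁ even) = R₁.1≁-1 (R₁.~-sym (proj₁ (R₁.parity k (u-product (suc zero))) even))
  byParity (inj₂ odd)  = R₀.1≁-1 (proj₂ (R₀.parity k (u-product zero)) odd)

everyUnitAProduct⇔s≡1 : ∀ {c ℓ} (n : ℕ) (R : Fin n → FiniteLocalRing c ℓ) (s : ℕ) →
  1 ≤ s → s ≤ n →
  (∀ i → toℕ i < s → FiniteLocalRing.ResidueCard (R i) 3) →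
  (∀ i → s ≤ toℕ i → LargeResidue (R i)) →
  (∀ u → IsUnit (directSum R) u → Σ ℕ λ k → 1 ≤ k × InProdExc (directSum R) k u) ⇔ s ≡ 1
everyUnitAProduct⇔s≡1 n R s 1≤s s≤n size3 large =
  mk⇔ (productsExist⇒s≡1 n R s 1≤s s≤n size3)
      (λ { ≡.refl → unitsAreProducts-s≡1 n R s≤n size3 large })

theorem1p9 : ∀ {c ℓ : Level} →
    -- (i)
    ((n : ℕ) (R : Fin n → FiniteLocalRing c ℓ) →
      (∀ i → Σ ℕ λ q → FiniteLocalRing.ResidueCard (R i) q × 3 < q) →
      ∀ u → IsUnit (directSum R) u ⇔ InProdExc (directSum R) 2 u)
    ×
    -- (ii)
    ((n : ℕ) (R : Fin n → FiniteLocalRing c ℓ) (s : ℕ) →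
      1 ≤ s → s ≤ n →
      (∀ i → toℕ i < s → FiniteLocalRing.ResidueCard (R i) 3) →
      (∀ i → s ≤ toℕ i → Σ ℕ λ q → FiniteLocalRing.ResidueCard (R i) q × 3 < q) →
      ((k : ℕ) → 2 ≤ k → ∀ u →
        InProdExc (directSum R) k u ⇔
          (((j : Fin n) →
              IsUnit (CommutativeRing.rawRing (FiniteLocalRing.ring (R j))) (u j))
           × ((i : Fin n) → toℕ i < s →
              (k % 2 ≡ 0 → FiniteLocalRing.In1+M (R i) (u i))
              × (k % 2 ≡ 1 → ¬ FiniteLocalRing.In1+M (R i) (u i)))))
      ×
      ((∀ u → IsUnit (directSum R) u →
          Σ ℕ λ k → 1 ≤ k × InProdExc (directSum R) k u) ⇔ s ≡ 1))
theorem1p9 =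
  unitsAreProductsOfTwo ,
  λ n R s 1≤s s≤n size3 large →
    productsOfK n R s size3 large , everyUnitAProduct⇔s≡1 n R s 1≤s s≤n size3 large
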